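{- Let $P_n$ be the path on $n$ vertices and $L=\{1,\dots,l\}$ the label set. If $|L|\ge 5n$, then Alice wins every ESD labeling game on $P_n$ with label set $L$.
   Context: For a graph $G=(V,E)$ and $l\in\mathbb N$, a vertex labeling $\phi:V\to\{1,\dots,l\}$ is an edge-sum distinguishing (ESD) labeling if $\phi$ is injective and the edge-weights $w_\phi(uv)=\phi(u)+\phi(v)$ are pairwise distinct over all edges $uv\in E$. ESD labeling game on $G$ with label set $L=\{1,\dots,l\}$: Alice and Bob alternate moves, Alice starting. In each move the player chooses a not-yet-labeled vertex and assigns to it a label from $L$ not used before; the move is legal if the edge-weights of edges with both endpoints labeled remain pairwise distinct. The game ends when no legal move is possible or an ESD labeling of $G$ is created; Alice wins if an ESD labeling is created, otherwise Bob wins. -}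

module Defs where

open import Data.Nat using (ℕ; zero; suc; _+_; _≤_)
open import Data.Fin using (Fin; toℕ; _≟_)
open import Data.Maybe using (Maybe; just; nothing)
open import Data.Product using (Σ; ∃; ∃-syntax; _×_; _,_)
open import Data.Sum using (_⊎_)
open import Relation.Nullary using (¬_; yes; no)
open import Relation.Binary.PropositionalEquality using (_≡_; _≢_)

-- A graph on vertex set Fin n, given by an edge predicate; each edge {u,v}
-- is represented by exactly one ordered pair (u , v).
EdgeRel : ℕ → Set₁
EdgeRel n = Fin n → Fin n → Set

PathEdge : (n : ℕ) → EdgeRel n
PathEdge n i j = toℕ j ≡ suc (toℕ i)

PartialLabeling : ℕ → Set
PartialLabeling n = Fin n → Maybe ℕ

emptyLabeling : (n : ℕ) → PartialLabeling n
emptyLabeling n _ = nothing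

assign : {n : ℕ} → PartialLabeling n → Fin n → ℕ → PartialLabeling n
assign s v a u with u ≟ v
... | yes _ = just a
... | no  _ = s u

DistinctWeights : {n : ℕ} → EdgeRel n → PartialLabeling n → Set
DistinctWeights {n} E s =
  ∀ (u v u' v' : Fin n) (a b a' b' : ℕ) →
  E u v → E u' v' → ¬ ((u ≡ u') × (v ≡ v')) →
  s u ≡ just a → s v ≡ just b → s u' ≡ just a' → s v' ≡ just b' →
  a + b ≢ a' + b'

Complete : {n : ℕ} → PartialLabeling n → Set
Complete {n} s = ∀ (v : Fin n) → ∃[ a ] (s v ≡ just a)

record LegalMove {n : ℕ} (E : EdgeRel n) (l : ℕ) (s : PartialLabeling n)
                 (v : Fin n) (a : ℕ) : Set where
  field
    unlabeled : s v ≡ nothing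
    label-min : 1 ≤ a
    label-max : a ≤ l
    unused    : ∀ (u : Fin n) → s u ≢ just a
    weights   : DistinctWeights E (assign s v a)

-- Alice wins from position s: the game ends with a complete labeling
-- (an ESD labeling) no matter how Bob plays.
mutual
  data AliceWinsAliceToMove {n : ℕ} (E : EdgeRel n) (l : ℕ)
       (s : PartialLabeling n) : Set where
    doneA : Complete s → AliceWinsAliceToMove E l s
    move  : (v : Fin n) (a : ℕ) → LegalMove E l s v a →
            AliceWinsBobToMove E l (assign s v a) →
            AliceWinsAliceToMove E l s

  data AliceWinsBobToMove {n : ℕ} (E : EdgeRel n) (l : ℕ)
       (s : PartialLabeling n) : Set where
    doneB : Complete s → AliceWinsBobToMove E l s
    reply : (∃[ v ] ∃[ a ] LegalMove E l s v a) →
            (∀ (v : Fin n) (a : ℕ) → LegalMove E l s v a →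
               AliceWinsAliceToMove E l (assign s v a)) →
            AliceWinsBobToMove E l s

AliceWinsESDGame : {n : ℕ} → EdgeRel n → ℕ → Set
AliceWinsESDGame {n} E l = AliceWinsAliceToMove E l (emptyLabeling n)

module Submission where

-- Call a partial labeling valid if its labels are pairwise distinct and the
-- weights of its fully labeled edges are pairwise distinct.  A legal move
-- keeps a position valid and labels one more vertex, so a play lasts at most
-- n moves.  Hence, on any graph, Alice wins as soon as every unlabeled vertex
-- of every valid position can be labeled legally: whatever either player
-- does, the play only stops once the labeling is complete
-- (aliceWinsIfExtendable).
--
-- On the path, a label a is illegal at an unlabeled vertex v = m only if a is
-- already used, or a + L(m+1) or L(m-1) + a equals the weight of an existing
-- edge (L = current labels, read as 0 where unlabeled).  This rules out at
-- most 3n values, so when 3n < l a free label in {1,…,l} exists by counting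
-- (missingLabel, pathExtendable).  Since 3n < 5n ≤ l for n ≥ 1 and the game
-- on P_0 is won at once, the theorem follows.

open import Defs
open import Data.Nat as ℕ using (ℕ; zero; suc; _+_; _*_; _∸_; _≤_; _<_; z≤n; s≤s; pred)
open import Data.Nat.Properties hiding (_≟_)
open import Data.Fin as Fin using (Fin; toℕ; _≟_)
open import Data.Fin.Properties using (toℕ-injective; any?; toℕ<n)
open import Data.Maybe using (Maybe; just; nothing)
open import Data.Maybe.Properties using (just-injective)
open import Data.List using (List; map; upTo; length; _++_; filter)
open import Data.List.Properties using (length-++; length-map; length-upTo; filter-notAll)
open import Data.List.Membership.Propositional using (_∈_; _∉_)
open import Data.List.Membership.Propositional.Properties
  using (∈-map⁺; ∈-++⁺ˡ; ∈-++⁺ʳ; ∈-upTo⁺; ∈-filter⁺)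
open import Data.List.Membership.DecPropositional ℕ._≟_ using (_∈?_)
import Data.List.Relation.Unary.Any as Any
open import Data.Product using (∃-syntax; _×_; _,_)
open import Data.Sum using (_⊎_; inj₁; inj₂)
open import Data.Empty using (⊥-elim)
open import Relation.Nullary using (¬_; yes; no; Dec; ¬?)
open import Relation.Binary.PropositionalEquality

-- Counting: a list of fewer than l numbers misses some label in {1,…,l}.
-- If l itself is in the list, delete all its copies (the list gets shorter)
-- and recurse on {1,…,l-1}.
differsFrom? : (m x : ℕ) → Dec (¬ x ≡ m)
differsFrom? m x = ¬? (x ℕ.≟ m)

missingLabel : (l : ℕ) (xs : List ℕ) → length xs < l → ∃[ a ] (1 ≤ a × a ≤ l × a ∉ xs)
missingLabel (suc l) xs len with suc l ∈? xs
... | no l∉xs = suc l , s≤s z≤n , ≤-refl , l∉xs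
... | yes l∈xs with missingLabel l (filter (differsFrom? (suc l)) xs) shorter
  where
  shorter : length (filter (differsFrom? (suc l)) xs) < l
  shorter = <-≤-trans (filter-notAll (differsFrom? (suc l)) xs
                                     (Any.map (λ x≡l x≢l → x≢l (sym x≡l)) l∈xs))
                      (≤-pred len)
... | a , 1≤a , a≤l , a∉rest =
  a , 1≤a , m≤n⇒m≤1+n a≤l ,
  λ a∈xs → a∉rest (∈-filter⁺ (differsFrom? (suc l)) a∈xs λ a≡l → <-irrefl a≡l (s≤s a≤l))

assign-self : {n : ℕ} (s : PartialLabeling n) (v : Fin n) (a : ℕ) → assign s v a v ≡ just a
assign-self s v a with v ≟ v
... | yes _ = refl
... | no v≢v = ⊥-elim (v≢v refl)

assign-inv : {n : ℕ} (s : PartialLabeling n) (v : Fin n) (a : ℕ) (u : Fin n) (x : ℕ) →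
             assign s v a u ≡ just x → (u ≡ v × x ≡ a) ⊎ s u ≡ just x
assign-inv s v a u x eq with u ≟ v
... | yes u≡v = inj₁ (u≡v , sym (just-injective eq))
... | no _ = inj₂ eq

-- Number of unlabeled vertices; every legal move lowers it, which bounds the
-- length of a play.
isUnlabeled : Maybe ℕ → ℕ
isUnlabeled nothing = 1
isUnlabeled (just _) = 0

unlabeledCount : {n : ℕ} → PartialLabeling n → ℕ
unlabeledCount {zero} s = 0
unlabeledCount {suc n} s = isUnlabeled (s Fin.zero) + unlabeledCount (λ u → s (Fin.suc u))

unlabeledCount≤n : {n : ℕ} (s : PartialLabeling n) → unlabeledCount s ≤ n
unlabeledCount≤n {zero} s = z≤n
unlabeledCount≤n {suc n} s with s Fin.zero
... | nothing = s≤s (unlabeledCount≤n _)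
... | just _ = m≤n⇒m≤1+n (unlabeledCount≤n _)

unlabeledCount-mono : {n : ℕ} (s t : PartialLabeling n) →
                      (∀ u → isUnlabeled (t u) ≤ isUnlabeled (s u)) →
                      unlabeledCount t ≤ unlabeledCount s
unlabeledCount-mono {zero} s t le = z≤n
unlabeledCount-mono {suc n} s t le =
  +-mono-≤ (le Fin.zero) (unlabeledCount-mono _ _ (λ u → le (Fin.suc u)))

unlabeledCount-strict : {n : ℕ} (s t : PartialLabeling n) (v : Fin n) →
                        (∀ u → isUnlabeled (t u) ≤ isUnlabeled (s u)) →
                        isUnlabeled (t v) < isUnlabeled (s v) →
                        unlabeledCount t < unlabeledCount s
unlabeledCount-strict {suc n} s t Fin.zero le lt =
  +-mono-<-≤ lt (unlabeledCount-mono _ _ (λ u → le (Fin.suc u)))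
unlabeledCount-strict {suc n} s t (Fin.suc v) le lt =
  +-mono-≤-< (le Fin.zero) (unlabeledCount-strict _ _ v (λ u → le (Fin.suc u)) lt)

assign-decreases : {n : ℕ} (s : PartialLabeling n) (v : Fin n) (a : ℕ) → s v ≡ nothing →
                   unlabeledCount (assign s v a) < unlabeledCount s
assign-decreases s v a sv≡nothing =
  unlabeledCount-strict s (assign s v a) v pointwise
    (subst₂ (λ t t' → isUnlabeled t < isUnlabeled t') (sym (assign-self s v a))
            (sym sv≡nothing) (s≤s z≤n))
  where
  pointwise : ∀ u → isUnlabeled (assign s v a u) ≤ isUnlabeled (s u)
  pointwise u with u ≟ v
  ... | yes _ = z≤n
  ... | no _ = ≤-refl

complete-or-unlabeled : {n : ℕ} (s : PartialLabeling n) → Complete s ⊎ (∃[ v ] s v ≡ nothing)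
complete-or-unlabeled s with any? (λ v → isNothing? (s v))
  where
  isNothing? : (m : Maybe ℕ) → Dec (m ≡ nothing)
  isNothing? nothing = yes refl
  isNothing? (just _) = no λ ()
... | yes unlabeled = inj₂ unlabeled
... | no noneUnlabeled = inj₁ λ v → labeled v (s v) refl
  where
  labeled : ∀ v m → s v ≡ m → ∃[ a ] (s v ≡ just a)
  labeled v nothing sv≡nothing = ⊥-elim (noneUnlabeled (v , sv≡nothing))
  labeled v (just a) sv≡a = a , sv≡a

LabelsInjective : {n : ℕ} → PartialLabeling n → Set
LabelsInjective {n} s = ∀ (u u' : Fin n) (x : ℕ) → s u ≡ just x → s u' ≡ just x → u ≡ u'

Valid : {n : ℕ} → EdgeRel n → PartialLabeling n → Set
Valid E s = DistinctWeights E s × LabelsInjective s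

emptyValid : {n : ℕ} (E : EdgeRel n) → Valid E (emptyLabeling n)
emptyValid E = (λ _ _ _ _ _ _ _ _ _ _ _ ()) , (λ _ _ _ ())

legalMove-valid : {n : ℕ} {E : EdgeRel n} {l : ℕ} (s : PartialLabeling n) (v : Fin n) (a : ℕ) →
                  Valid E s → LegalMove E l s v a → Valid E (assign s v a)
legalMove-valid s v a (_ , inj) legal = LegalMove.weights legal , injective
  where
  injective : LabelsInjective (assign s v a)
  injective u u' x su su' with assign-inv s v a u x su | assign-inv s v a u' x su'
  ... | inj₁ (u≡v , _) | inj₁ (u'≡v , _) = trans u≡v (sym u'≡v)
  ... | inj₁ (_ , refl) | inj₂ old = ⊥-elim (LegalMove.unused legal u' old)
  ... | inj₂ old | inj₁ (_ , refl) = ⊥-elim (LegalMove.unused legal u old)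
  ... | inj₂ old | inj₂ old' = inj u u' x old old'

Extendable : {n : ℕ} → EdgeRel n → ℕ → Set
Extendable {n} E l = ∀ (s : PartialLabeling n) → Valid E s → (v : Fin n) → s v ≡ nothing →
                     ∃[ a ] LegalMove E l s v a

-- On an extendable graph Alice wins from every valid position, whoever is to
-- move: induction on the number of unlabeled vertices (bounded by the fuel k).
module _ {n : ℕ} {E : EdgeRel n} {l : ℕ} (extendable : Extendable E l) where

  mutual
    aliceToMove : (k : ℕ) (s : PartialLabeling n) → Valid E s → unlabeledCount s ≤ k →
                  AliceWinsAliceToMove E l s
    aliceToMove k s valid count with complete-or-unlabeled s
    ... | inj₁ complete = doneA complete
    ... | inj₂ (v , sv) with extendable s valid v sv | k
    ... | a , _ | zero = ⊥-elim (n≮0 (<-≤-trans (assign-decreases s v a sv) count))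
    ... | a , legal | suc k =
      move v a legal (bobToMove k (assign s v a) (legalMove-valid s v a valid legal)
                                  (≤-pred (<-≤-trans (assign-decreases s v a sv) count)))

    bobToMove : (k : ℕ) (s : PartialLabeling n) → Valid E s → unlabeledCount s ≤ k →
                AliceWinsBobToMove E l s
    bobToMove k s valid count with complete-or-unlabeled s
    ... | inj₁ complete = doneB complete
    ... | inj₂ (v , sv) with extendable s valid v sv | k
    ... | a , _ | zero = ⊥-elim (n≮0 (<-≤-trans (assign-decreases s v a sv) count))
    ... | a , legal | suc k = reply (v , a , legal) λ v' a' legal' →
      aliceToMove k (assign s v' a') (legalMove-valid s v' a' valid legal')
        (≤-pred (<-≤-trans (assign-decreases s v' a' (LegalMove.unlabeled legal')) count))

  aliceWinsIfExtendable : AliceWinsESDGame E l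
  aliceWinsIfExtendable = aliceToMove n (emptyLabeling n) (emptyValid E) (unlabeledCount≤n _)

-- The path.  Labels are read off by position, with 0 at unlabeled vertices
-- (0 is never a legal label, so it never causes a spurious conflict).
labelValue : Maybe ℕ → ℕ
labelValue nothing = 0
labelValue (just x) = x

labelAt : {n : ℕ} → PartialLabeling n → ℕ → ℕ
labelAt {zero} s k = 0
labelAt {suc n} s zero = labelValue (s Fin.zero)
labelAt {suc n} s (suc k) = labelAt (λ u → s (Fin.suc u)) k

labelAt-just : {n : ℕ} (s : PartialLabeling n) (u : Fin n) {x : ℕ} →
               s u ≡ just x → labelAt s (toℕ u) ≡ x
labelAt-just {suc n} s Fin.zero su = cong labelValue su
labelAt-just {suc n} s (Fin.suc u) su = labelAt-just (λ w → s (Fin.suc w)) u su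

edgeWeight : {n : ℕ} → PartialLabeling n → ℕ → ℕ
edgeWeight s k = labelAt s k + labelAt s (suc k)

edgeWeight-labeled : {n : ℕ} (s : PartialLabeling n) {u w : Fin n} {x y : ℕ} →
                     PathEdge n u w → s u ≡ just x → s w ≡ just y → edgeWeight s (toℕ u) ≡ x + y
edgeWeight-labeled s {u} {w} uw su sw =
  cong₂ _+_ (labelAt-just s u su) (trans (cong (labelAt s) (sym uw)) (labelAt-just s w sw))

overPositions : (n : ℕ) → (ℕ → ℕ) → List ℕ
overPositions n f = map f (upTo n)

∈-overPositions : {n : ℕ} (f : ℕ → ℕ) (u : Fin n) → f (toℕ u) ∈ overPositions n f
∈-overPositions f u = ∈-map⁺ f (∈-upTo⁺ (toℕ<n u))

length-overPositions : (n : ℕ) (f : ℕ → ℕ) → length (overPositions n f) ≡ n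
length-overPositions n f = trans (length-map f (upTo n)) (length-upTo n)

-- The labels that cannot go on position m: labels in use, and labels that
-- would give the new edge {m, m+1} resp. {m-1, m} an existing edge weight.
usedLabels : {n : ℕ} → PartialLabeling n → List ℕ
usedLabels {n} s = overPositions n (labelAt s)

rightClashes leftClashes : {n : ℕ} → PartialLabeling n → ℕ → List ℕ
rightClashes {n} s m = overPositions n (λ k → edgeWeight s k ∸ labelAt s (suc m))
leftClashes {n} s m = overPositions n (λ k → edgeWeight s k ∸ labelAt s (pred m))

forbidden : {n : ℕ} → PartialLabeling n → ℕ → List ℕ
forbidden s m = usedLabels s ++ (rightClashes s m ++ leftClashes s m)

length-forbidden : {n : ℕ} (s : PartialLabeling n) (m : ℕ) → length (forbidden s m) ≡ 3 * n
length-forbidden {n} s m = begin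
  length (usedLabels s ++ (rightClashes s m ++ leftClashes s m))
    ≡⟨ length-++ (usedLabels s) ⟩
  length (usedLabels s) + length (rightClashes s m ++ leftClashes s m)
    ≡⟨ cong (length (usedLabels s) +_) (length-++ (rightClashes s m)) ⟩
  length (usedLabels s) + (length (rightClashes s m) + length (leftClashes s m))
    ≡⟨ cong₂ _+_ (length-overPositions n _)
                 (cong₂ _+_ (length-overPositions n _) (length-overPositions n _)) ⟩
  n + (n + n)
    ≡⟨ cong (λ k → n + (n + k)) (sym (+-identityʳ n)) ⟩
  3 * n ∎
  where open ≡-Reasoning

data EdgeAfterAssign {n : ℕ} (s : PartialLabeling n) (v : Fin n) (a : ℕ)
                     (u w : Fin n) (x y : ℕ) : Set where
  oldEdge  : s u ≡ just x → s w ≡ just y → EdgeAfterAssign s v a u w x y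
  startsAt : u ≡ v → x ≡ a → s w ≡ just y → EdgeAfterAssign s v a u w x y
  endsAt   : w ≡ v → y ≡ a → s u ≡ just x → EdgeAfterAssign s v a u w x y

classifyEdge : {n : ℕ} (s : PartialLabeling n) (v : Fin n) (a : ℕ) {u w : Fin n} {x y : ℕ} →
               PathEdge n u w → assign s v a u ≡ just x → assign s v a w ≡ just y →
               EdgeAfterAssign s v a u w x y
classifyEdge s v a {u} {w} {x} {y} uw su sw
  with assign-inv s v a u x su | assign-inv s v a w y sw
... | inj₁ (refl , _) | inj₁ (refl , _) = ⊥-elim (<-irrefl uw (n<1+n (toℕ u)))
... | inj₁ (u≡v , x≡a) | inj₂ old = startsAt u≡v x≡a old
... | inj₂ old | inj₁ (w≡v , y≡a) = endsAt w≡v y≡a old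
... | inj₂ old | inj₂ old' = oldEdge old old'

-- A new edge {v, v+1} cannot share its weight with an old edge, because
-- a ∉ rightClashes; symmetrically for {v-1, v} and leftClashes.
module _ {n : ℕ} (s : PartialLabeling n) (v : Fin n) {a : ℕ} (a∉ : a ∉ forbidden s (toℕ v))
         {u' w' : Fin n} {x' y' : ℕ} (e' : PathEdge n u' w') (su' : s u' ≡ just x')
         (sw' : s w' ≡ just y') where
  open ≡-Reasoning

  startEdge-vs-old : {w : Fin n} {y : ℕ} → PathEdge n v w → s w ≡ just y → a + y ≢ x' + y'
  startEdge-vs-old {w} {y} e sw same =
    a∉ (∈-++⁺ʳ (usedLabels s) (∈-++⁺ˡ (subst (_∈ rightClashes s (toℕ v)) a-clashes
                                             (∈-overPositions _ u'))))
    where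
    a-clashes : edgeWeight s (toℕ u') ∸ labelAt s (suc (toℕ v)) ≡ a
    a-clashes = begin
      edgeWeight s (toℕ u') ∸ labelAt s (suc (toℕ v))
        ≡⟨ cong₂ _∸_ (edgeWeight-labeled s e' su' sw')
                     (trans (cong (labelAt s) (sym e)) (labelAt-just s w sw)) ⟩
      x' + y' ∸ y  ≡⟨ cong (_∸ y) (sym same) ⟩
      a + y ∸ y    ≡⟨ m+n∸n≡m a y ⟩
      a            ∎

  endEdge-vs-old : {u : Fin n} {x : ℕ} → PathEdge n u v → s u ≡ just x → x + a ≢ x' + y'
  endEdge-vs-old {u} {x} e su same =
    a∉ (∈-++⁺ʳ (usedLabels s) (∈-++⁺ʳ (rightClashes s (toℕ v))
         (subst (_∈ leftClashes s (toℕ v)) a-clashes (∈-overPositions _ u'))))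
    where
    a-clashes : edgeWeight s (toℕ u') ∸ labelAt s (pred (toℕ v)) ≡ a
    a-clashes = begin
      edgeWeight s (toℕ u') ∸ labelAt s (pred (toℕ v))
        ≡⟨ cong₂ _∸_ (edgeWeight-labeled s e' su' sw')
                     (trans (cong (λ k → labelAt s (pred k)) e) (labelAt-just s u su)) ⟩
      x' + y' ∸ x  ≡⟨ cong (_∸ x) (sym same) ⟩
      x + a ∸ x    ≡⟨ m+n∸m≡n x a ⟩
      a            ∎

-- The two new edges {v, v+1} and {v-1, v} have different weights: otherwise
-- v+1 and v-1 would carry the same label.
startEdge-vs-endEdge : {n : ℕ} (s : PartialLabeling n) → LabelsInjective s → {v w u : Fin n}
                       {a y x : ℕ} → PathEdge n v w → PathEdge n u v →
                       s w ≡ just y → s u ≡ just x → a + y ≢ x + a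
startEdge-vs-endEdge s inj {v} {w} {u} {a} {y} {x} vw uv sw su same =
  <-irrefl v≡v+2 (<-trans (n<1+n (toℕ v)) (n<1+n (suc (toℕ v))))
  where
  y≡x : y ≡ x
  y≡x = +-cancelˡ-≡ a y x (trans same (+-comm x a))
  w≡u : w ≡ u
  w≡u = inj w u y sw (subst (λ z → s u ≡ just z) (sym y≡x) su)
  v≡v+2 : toℕ v ≡ suc (suc (toℕ v))
  v≡v+2 = trans uv (cong suc (trans (cong toℕ (sym w≡u)) vw))

forbidden-complement-safe : {n : ℕ} (s : PartialLabeling n) → Valid (PathEdge n) s →
                            (v : Fin n) (a : ℕ) → a ∉ forbidden s (toℕ v) →
                            DistinctWeights (PathEdge n) (assign s v a)
forbidden-complement-safe s (distinct , inj) v a a∉ u w u' w' x y x' y' e e' different su sw su' sw'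
  with classifyEdge s v a e su sw | classifyEdge s v a e' su' sw'
... | oldEdge p q | oldEdge p' q' = distinct u w u' w' x y x' y' e e' different p q p' q'
... | startsAt refl refl q | oldEdge p' q' = startEdge-vs-old s v a∉ e' p' q' e q
... | oldEdge p q | startsAt refl refl q' = ≢-sym (startEdge-vs-old s v a∉ e p q e' q')
... | endsAt refl refl p | oldEdge p' q' = endEdge-vs-old s v a∉ e' p' q' e p
... | oldEdge p q | endsAt refl refl p' = ≢-sym (endEdge-vs-old s v a∉ e p q e' p')
... | startsAt refl refl _ | startsAt refl refl _ =
  ⊥-elim (different (refl , toℕ-injective (trans e (sym e'))))
... | endsAt refl refl _ | endsAt refl refl _ =
  ⊥-elim (different (toℕ-injective (suc-injective (trans (sym e) e')) , refl))
... | startsAt refl refl q | endsAt refl refl p' = startEdge-vs-endEdge s inj e e' q p'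
... | endsAt refl refl p | startsAt refl refl q' = ≢-sym (startEdge-vs-endEdge s inj e' e q' p)

pathExtendable : {n l : ℕ} → 3 * n < l → Extendable (PathEdge n) l
pathExtendable {n} {l} bound s valid v sv
  with missingLabel l (forbidden s (toℕ v)) (subst (_< l) (sym (length-forbidden s (toℕ v))) bound)
... | a , 1≤a , a≤l , a∉ = a , record
  { unlabeled = sv
  ; label-min = 1≤a
  ; label-max = a≤l
  ; unused    = λ u su → a∉ (∈-++⁺ˡ (subst (_∈ usedLabels s) (labelAt-just s u su)
                                           (∈-overPositions _ u)))
  ; weights   = forbidden-complement-safe s valid v a a∉
  }

theorem14 : (n l : ℕ) → 5 * n ≤ l → AliceWinsESDGame (PathEdge n) l
theorem14 zero l _ = doneA (λ ())
theorem14 (suc n) l 5n≤l = aliceWinsIfExtendable (pathExtendable (<-≤-trans 3n<5n 5n≤l))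
  where
  3n<5n : 3 * suc n < 5 * suc n
  3n<5n = *-monoˡ-< (suc n) {3} {5} (s≤s (s≤s (s≤s (s≤s z≤n))))
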